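{- Let $A$ be a finite set, $(M,\cdot)$ a commutative monoid, $k\in\mathbb{N}$, and $w:A^k\to M$ a weight map. Suppose there is $a\in A^k$ such that $w(a)$ is cancellative in $M$ (i.e. $w(a)x=w(a)y$ implies $x=y$). Then $\mathrm{Pol}(w)$ is borrow closed.
   Context: $B_n(A)=\mathrm{Sym}(A^n)$, $B(A)=\bigcup_n B_n(A)$; $i_1$ is the identity of $A$; for $f\in B_n(A)$, $g\in B_m(A)$, $f\oplus g\in B_{n+m}(A)$ applies $f$ to the first $n$ coordinates and $g$ to the last $m$. For a $k\times n$ array $a$ over $A$ and $f\in B_n(A)$, $f(a)$ denotes the array obtained by applying $f$ to each row of $a$, and $w(a)=\prod_{i=1}^n w(\text{$i$-th column of }a)$. $f\in B_n(A)$ respects $w$ if $w(a)=w(f(a))$ for every $k\times n$ array $a$ over $A$; $\mathrm{Pol}(w)$ is the set of all $f\in B(A)$ respecting $w$. A set $C\subseteq B(A)$ is borrow closed if for all $f\in B(A)$, $f\oplus i_1\in C$ implies $f\in C$. -}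

module Defs where

open import Level using (Level; _⊔_)
open import Data.Nat using (ℕ; zero; suc; _+_)
open import Data.Fin using (Fin)
open import Data.Vec using (Vec; []; _∷_; _++_; take; drop; map; transpose; foldr)
open import Data.Vec.Properties using (take++drop≡id)
open import Data.Product using (Σ; _,_; proj₁; proj₂)
open import Function using (_∘_; id)
open import Function.Bundles using (_↔_; Inverse; mk↔ₛ′)
open import Relation.Binary.PropositionalEquality using (_≡_; refl; cong; cong₂)
open import Algebra.Bundles using (CommutativeMonoid)

-- The finite set A is taken to be Fin s (any finite set is in bijection with one).

B : ∀ {a} → Set a → ℕ → Set a
B A n = Vec A n ↔ Vec A n

BAll : ∀ {a} → Set a → Set a
BAll A = Σ ℕ (B A)

i₁ : ∀ {a} {A : Set a} → B A 1
i₁ = mk↔ₛ′ id id (λ _ → refl) (λ _ → refl)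

private
  take-++ : ∀ {a} {A : Set a} n {m} (xs : Vec A n) (ys : Vec A m) → take n (xs ++ ys) ≡ xs
  take-++ zero [] ys = refl
  take-++ (suc n) (x ∷ xs) ys = cong (x ∷_) (take-++ n xs ys)

  drop-++ : ∀ {a} {A : Set a} n {m} (xs : Vec A n) (ys : Vec A m) → drop n (xs ++ ys) ≡ ys
  drop-++ zero [] ys = refl
  drop-++ (suc n) (x ∷ xs) ys = drop-++ n xs ys

_⊕_ : ∀ {a} {A : Set a} {n m} → B A n → B A m → B A (n + m)
_⊕_ {n = n} f g = mk↔ₛ′ to′ from′ invˡ invʳ
  where
  open Inverse
  to′ = λ xs → to f (take n xs) ++ to g (drop n xs)
  from′ = λ xs → from f (take n xs) ++ from g (drop n xs)
  invˡ : ∀ y → to′ (from′ y) ≡ y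
  invˡ y rewrite take-++ n (from f (take n y)) (from g (drop n y))
               | drop-++ n (from f (take n y)) (from g (drop n y))
               | strictlyInverseˡ f (take n y) | strictlyInverseˡ g (drop n y)
               = take++drop≡id n y
  invʳ : ∀ y → from′ (to′ y) ≡ y
  invʳ y rewrite take-++ n (to f (take n y)) (to g (drop n y))
               | drop-++ n (to f (take n y)) (to g (drop n y))
               | strictlyInverseʳ f (take n y) | strictlyInverseʳ g (drop n y)
               = take++drop≡id n y

module _ {c ℓ} (M : CommutativeMonoid c ℓ) where
  open CommutativeMonoid M renaming (Carrier to |M|)

  prod : ∀ {n} → Vec |M| n → |M|
  prod = foldr _ _∙_ ε

  module _ {a} {A : Set a} {k : ℕ} (w : Vec A k → |M|) where

    -- a k×n array over A, given as k rows of length n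
    Array : ℕ → Set a
    Array n = Vec (Vec A n) k

    wArr : ∀ {n} → Array n → |M|
    wArr a = prod (map w (transpose a))

    applyRows : ∀ {n} → B A n → Array n → Array n
    applyRows f a = map (Inverse.to f) a

    Respects : ∀ {n} → B A n → Set (a ⊔ ℓ)
    Respects f = ∀ (ar : Array _) → wArr ar ≈ wArr (applyRows f ar)

    Pol : BAll A → Set (a ⊔ ℓ)
    Pol (n , f) = Respects f

  Cancellative : |M| → Set (c ⊔ ℓ)
  Cancellative u = ∀ x y → u ∙ x ≈ u ∙ y → x ≈ y

BorrowClosed : ∀ {a p} {A : Set a} → (BAll A → Set p) → Set (a ⊔ p)
BorrowClosed {A = A} C = ∀ n (f : B A n) → C (n + 1 , f ⊕ i₁) → C (n , f)

{-# OPTIONS --safe #-}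
module Submission where

open import Defs
open import Level using (Level)
open import Data.Nat using (ℕ; zero; suc; _+_)
open import Data.Fin using (Fin)
open import Data.Vec using (Vec; []; _∷_; _++_; [_]; take; drop; map; transpose; zipWith; replicate; _⊛_)
open import Data.Vec.Properties using (map-++; map-id)
open import Data.Product using (Σ; _,_)
open import Function using (_∘′_)
open import Function.Bundles using (Inverse)
open import Relation.Binary.PropositionalEquality using (_≡_; refl; cong; cong₂; module ≡-Reasoning)
open import Algebra.Bundles using (CommutativeMonoid)

-- The weight of an array is multiplicative under horizontal concatenation, and f ⊕ g acts on a
-- concatenation blockwise. So if f ⊕ i₁ respects w, appending the column a (which i₁ fixes) to an
-- array ar gives w(ar) w(a) = w(f(ar)) w(a), and w(a) can be cancelled.

private
  variable
    ℓ₁ ℓ₂ : Level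
    A : Set ℓ₁
    C : Set ℓ₂
    k m n : ℕ

replicate-++ : ∀ m n (x : A) → replicate (m + n) x ≡ replicate m x ++ replicate n x
replicate-++ zero    n x = refl
replicate-++ (suc m) n x = cong (x ∷_) (replicate-++ m n x)

⊛-++ : (fs : Vec (A → C) m) (gs : Vec (A → C) n) (xs : Vec A m) (ys : Vec A n) →
       ((fs ++ gs) ⊛ (xs ++ ys)) ≡ (fs ⊛ xs) ++ (gs ⊛ ys)
⊛-++ []       gs []       ys = refl
⊛-++ (f ∷ fs) gs (x ∷ xs) ys = cong (f x ∷_) (⊛-++ fs gs xs ys)

transpose-zipWith-++ : (xss : Vec (Vec A m) k) (yss : Vec (Vec A n) k) →
                       transpose (zipWith _++_ xss yss) ≡ transpose xss ++ transpose yss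
transpose-zipWith-++ {m = m} {n = n} []         []         = replicate-++ m n []
transpose-zipWith-++ {m = m} {n = n} (xs ∷ xss) (ys ∷ yss) = begin
  (replicate (m + n) _∷_ ⊛ (xs ++ ys) ⊛ transpose (zipWith _++_ xss yss))
    ≡⟨ cong₂ (λ fs zss → fs ⊛ (xs ++ ys) ⊛ zss) (replicate-++ m n _∷_) (transpose-zipWith-++ xss yss) ⟩
  ((replicate m _∷_ ++ replicate n _∷_) ⊛ (xs ++ ys) ⊛ (transpose xss ++ transpose yss))
    ≡⟨ cong (_⊛ (transpose xss ++ transpose yss)) (⊛-++ (replicate m _∷_) (replicate n _∷_) xs ys) ⟩
  (((replicate m _∷_ ⊛ xs) ++ (replicate n _∷_ ⊛ ys)) ⊛ (transpose xss ++ transpose yss))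
    ≡⟨ ⊛-++ (replicate m _∷_ ⊛ xs) (replicate n _∷_ ⊛ ys) (transpose xss) (transpose yss) ⟩
  transpose (xs ∷ xss) ++ transpose (ys ∷ yss) ∎
  where open ≡-Reasoning

transpose-column : (v : Vec A k) → transpose (map [_] v) ≡ [ v ]
transpose-column []      = refl
transpose-column (x ∷ v) = cong (λ zss → (x ∷_) ∷ [] ⊛ zss) (transpose-column v)

take-++ : ∀ m (xs : Vec A m) (ys : Vec A n) → take m (xs ++ ys) ≡ xs
take-++ zero    []       ys = refl
take-++ (suc m) (x ∷ xs) ys = cong (x ∷_) (take-++ m xs ys)

drop-++ : ∀ m (xs : Vec A m) (ys : Vec A n) → drop m (xs ++ ys) ≡ ys
drop-++ zero    []       ys = refl
drop-++ (suc m) (x ∷ xs) ys = drop-++ m xs ys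

⊕-++ : (f : B A m) (g : B A n) (xs : Vec A m) (ys : Vec A n) →
       Inverse.to (f ⊕ g) (xs ++ ys) ≡ Inverse.to f xs ++ Inverse.to g ys
⊕-++ {m = m} f g xs ys =
  cong₂ (λ us vs → Inverse.to f us ++ Inverse.to g vs) (take-++ m xs ys) (drop-++ m xs ys)

map-⊕-zipWith-++ : (f : B A m) (g : B A n) (xss : Vec (Vec A m) k) (yss : Vec (Vec A n) k) →
                   map (Inverse.to (f ⊕ g)) (zipWith _++_ xss yss) ≡
                   zipWith _++_ (map (Inverse.to f) xss) (map (Inverse.to g) yss)
map-⊕-zipWith-++ f g []         []         = refl
map-⊕-zipWith-++ f g (xs ∷ xss) (ys ∷ yss) = cong₂ _∷_ (⊕-++ f g xs ys) (map-⊕-zipWith-++ f g xss yss)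

module _ {c ℓ} (M : CommutativeMonoid c ℓ) where
  open CommutativeMonoid M renaming (Carrier to |M|)
  open import Relation.Binary.Reasoning.Setoid setoid

  prod-++ : (xs : Vec |M| m) (ys : Vec |M| n) → prod M (xs ++ ys) ≈ prod M xs ∙ prod M ys
  prod-++ []       ys = sym (identityˡ (prod M ys))
  prod-++ (x ∷ xs) ys = begin
    x ∙ prod M (xs ++ ys)         ≈⟨ ∙-congˡ (prod-++ xs ys) ⟩
    x ∙ (prod M xs ∙ prod M ys)   ≈⟨ sym (assoc x _ _) ⟩
    (x ∙ prod M xs) ∙ prod M ys   ∎

  cancellative-resp : ∀ {u v} → u ≈ v → Cancellative M u → Cancellative M v
  cancellative-resp u≈v cancel x y v∙x≈v∙y =
    cancel x y (trans (∙-congʳ u≈v) (trans v∙x≈v∙y (∙-congʳ (sym u≈v))))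

  module _ {a} {A : Set a} {k : ℕ} (w : Vec A k → |M|) where

    wArr-zipWith-++ : (ar : Array M w m) (br : Array M w n) →
                      wArr M w (zipWith _++_ ar br) ≈ wArr M w ar ∙ wArr M w br
    wArr-zipWith-++ ar br = begin
      prod M (map w (transpose (zipWith _++_ ar br)))
        ≡⟨ cong (prod M ∘′ map w) (transpose-zipWith-++ ar br) ⟩
      prod M (map w (transpose ar ++ transpose br))
        ≡⟨ cong (prod M) (map-++ w (transpose ar) (transpose br)) ⟩
      prod M (map w (transpose ar) ++ map w (transpose br))
        ≈⟨ prod-++ (map w (transpose ar)) (map w (transpose br)) ⟩
      wArr M w ar ∙ wArr M w br ∎

    i₁-respects : Respects M w i₁
    i₁-respects ar = sym (reflexive (cong (wArr M w) (map-id ar)))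

    wArr-column : (v : Vec A k) → wArr M w (map [_] v) ≈ w v
    wArr-column v = begin
      prod M (map w (transpose (map [_] v))) ≡⟨ cong (prod M ∘′ map w) (transpose-column v) ⟩
      w v ∙ ε                                ≈⟨ identityʳ (w v) ⟩
      w v                                    ∎

    ⊕-respects⇒respectsˡ : (f : B A m) (g : B A n) (br : Array M w n) → Cancellative M (wArr M w br) →
                           Respects M w g → Respects M w (f ⊕ g) → Respects M w f
    ⊕-respects⇒respectsˡ f g br cancel g-respects f⊕g-respects ar = cancel _ _ (begin
      wArr M w br ∙ wArr M w ar                               ≈⟨ comm _ _ ⟩
      wArr M w ar ∙ wArr M w br                               ≈⟨ wArr-zipWith-++ ar br ⟨
      wArr M w (zipWith _++_ ar br)                           ≈⟨ f⊕g-respects (zipWith _++_ ar br) ⟩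
      wArr M w (applyRows M w (f ⊕ g) (zipWith _++_ ar br))   ≡⟨ cong (wArr M w) (map-⊕-zipWith-++ f g ar br) ⟩
      wArr M w (zipWith _++_ (applyRows M w f ar) (applyRows M w g br))
                                                              ≈⟨ wArr-zipWith-++ (applyRows M w f ar) (applyRows M w g br) ⟩
      wArr M w (applyRows M w f ar) ∙ wArr M w (applyRows M w g br) ≈⟨ ∙-congˡ (g-respects br) ⟨
      wArr M w (applyRows M w f ar) ∙ wArr M w br             ≈⟨ comm _ _ ⟩
      wArr M w br ∙ wArr M w (applyRows M w f ar)             ∎)

theorem3 : ∀ {c ℓ} (s : ℕ) (M : CommutativeMonoid c ℓ) (k : ℕ)
             (w : Vec (Fin s) k → CommutativeMonoid.Carrier M) →
             Σ (Vec (Fin s) k) (λ a → Cancellative M (w a)) →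
             BorrowClosed (Pol M w)
theorem3 s M k w (v , cancel) n f =
  ⊕-respects⇒respectsˡ M w f i₁ (map [_] v) column-cancellative (i₁-respects M w)
  where
  column-cancellative : Cancellative M (wArr M w (map [_] v))
  column-cancellative = cancellative-resp M (CommutativeMonoid.sym M (wArr-column M w v)) cancel
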